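{- Let $a, b, d_1, d_2, m$ be integers satisfying \[a\equiv 1 \pmod{12},\qquad b = 2^{d_1}a - 3^m \text{ with } m \text{ an odd positive integer},\qquad d_1\ge 3,\ 3\mid d_1,\qquad d_2\ge 2,\ 2\mid d_2,\qquad \gcd(d_1,d_2)=1.\] Then the equation \[a x^{d_1} - y^{d_2} - z^2 + xyz - b = 0\] has no integer solution $(x,y,z)\in\mathbb{Z}^3$ with $x$ even. -}

module Defs where

-- Modulo 4 the equation collapses.  Write x = 2t.  Since d₁ ≥ 2 the terms a x^d₁ and 2^d₁ a
-- vanish, 3^m ≡ 3 because m is odd, and y^d₂ ≡ y² because d₂ is even, so a solution would give
-- y² + z² − 2tyz ≡ 3 (mod 4).  The left side mod 4 only depends on the parities of t, y and z,
-- and none of the eight parity patterns yields 3.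
module Submission where

open import Defs
open import Data.Nat using (ℕ; _≤_; _≥_)
open import Data.Nat.GCD using (gcd)
open import Data.Integer using (ℤ; +_; _+_; _-_; _*_; _^_)
open import Data.Integer.Divisibility using () renaming (_∣_ to _∣ℤ_)
open import Data.Nat.Divisibility using (_∣_)
open import Data.Product using (∃; _×_; Σ)
open import Relation.Binary.PropositionalEquality using (_≡_)
open import Relation.Nullary using (¬_)

open import Data.Nat using (zero; suc; s≤s; _<_)
import Data.Nat.Divisibility as ℕ
import Data.Nat as ℕ
import Data.Nat.Properties as ℕ
open import Data.Integer using (1ℤ; _%_; _/_)
open import Data.Integer.Properties using (*-assoc; *-identityˡ; *-identityʳ; +-identityʳ; ^-*-assoc; ^-zeroˡ)
open import Data.Integer.DivMod using (n%d<d; a≡a%n+[a/n]*n)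
open import Data.Integer.Divisibility.Signed
  using (divides; ∣ᵤ⇒∣; _∣?_; ∣-refl; ∣m∣n⇒∣m+n; ∣m∣n⇒∣m-n; ∣m⇒∣-m; ∣m⇒∣m*n; ∣n⇒∣m*n; *-monoˡ-∣)
  renaming (_∣_ to _∣ₛ_)
open import Data.Integer.Tactic.RingSolver using (solve; solve-∀)
open import Data.Fin as Fin using (Fin; toℕ; fromℕ<)
open import Data.Fin.Properties using (all?; toℕ-fromℕ<)
open import Data.List using ([]; _∷_)
open import Data.Product using (_,_)
open import Function using (_∘_)
open import Relation.Binary.Bundles using (Setoid)
import Relation.Binary.Reasoning.Setoid
open import Relation.Binary.PropositionalEquality using (refl; sym; cong; module ≡-Reasoning)
open import Relation.Nullary using (Dec; ¬?; contradiction)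
open import Relation.Nullary.Decidable using (from-yes; map′)

private variable
  n t t′ x y y′ z z′ u v : ℤ

-- Unlike subst, this fixes u before the equation is elaborated, so the ring solver sees both sides.
∣-respʳ-≡ : n ∣ₛ u → u ≡ v → n ∣ₛ v
∣-respʳ-≡ n∣u refl = n∣u

infix 4 _≡_mod_
record _≡_mod_ (x y n : ℤ) : Set where
  constructor mod-by
  field ∣-difference : n ∣ₛ x - y

≡-mod-reflexive : x ≡ y → x ≡ y mod n
≡-mod-reflexive {x} refl = mod-by (divides (+ 0) (solve (x ∷ [])))

≡-mod-refl : x ≡ x mod n
≡-mod-refl = ≡-mod-reflexive refl

≡-mod-sym : x ≡ y mod n → y ≡ x mod n
≡-mod-sym {x} {y} (mod-by n∣x-y) = mod-by (∣-respʳ-≡ (∣m⇒∣-m n∣x-y) (solve (x ∷ y ∷ [])))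

≡-mod-trans : x ≡ y mod n → y ≡ u mod n → x ≡ u mod n
≡-mod-trans {x} {y} {u = u} (mod-by n∣x-y) (mod-by n∣y-u) =
  mod-by (∣-respʳ-≡ (∣m∣n⇒∣m+n n∣x-y n∣y-u) (solve (x ∷ y ∷ u ∷ [])))

infix 4 _≡?_mod_
_≡?_mod_ : ∀ x y n → Dec (x ≡ y mod n)
x ≡? y mod n = map′ mod-by _≡_mod_.∣-difference (n ∣? x - y)

≡-mod-setoid : ℤ → Setoid _ _
≡-mod-setoid n = record
  { Carrier = ℤ
  ; _≈_ = _≡_mod n
  ; isEquivalence = record
    { refl = ≡-mod-refl ; sym = ≡-mod-sym ; trans = ≡-mod-trans } }

module ≡-mod-Reasoning (n : ℤ) = Relation.Binary.Reasoning.Setoid (≡-mod-setoid n)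

+-cong-mod : x ≡ y mod n → u ≡ v mod n → x + u ≡ y + v mod n
+-cong-mod {x} {y} {u = u} {v} (mod-by n∣x-y) (mod-by n∣u-v) =
  mod-by (∣-respʳ-≡ (∣m∣n⇒∣m+n n∣x-y n∣u-v) (solve (x ∷ y ∷ u ∷ v ∷ [])))

minus-cong-mod : x ≡ y mod n → u ≡ v mod n → x - u ≡ y - v mod n
minus-cong-mod {x} {y} {u = u} {v} (mod-by n∣x-y) (mod-by n∣u-v) =
  mod-by (∣-respʳ-≡ (∣m∣n⇒∣m-n n∣x-y n∣u-v) (solve (x ∷ y ∷ u ∷ v ∷ [])))

*-cong-mod : x ≡ y mod n → u ≡ v mod n → x * u ≡ y * v mod n
*-cong-mod {x} {y} {u = u} {v} (mod-by n∣x-y) (mod-by n∣u-v) =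
  mod-by (∣-respʳ-≡ (∣m∣n⇒∣m+n (∣m⇒∣m*n u n∣x-y) (∣n⇒∣m*n y n∣u-v))
                    (solve (x ∷ y ∷ u ∷ v ∷ [])))

^-cong-mod : x ≡ y mod n → ∀ k → x ^ k ≡ y ^ k mod n
^-cong-mod x≡y zero    = ≡-mod-refl
^-cong-mod x≡y (suc k) = *-cong-mod x≡y (^-cong-mod x≡y k)

*-scale-mod : ∀ k → x ≡ y mod n → x * k ≡ y * k mod n * k
*-scale-mod {x} {y} k (mod-by n∣x-y) =
  mod-by (∣-respʳ-≡ {u = (x - y) * k} (*-monoˡ-∣ k n∣x-y) (solve (x ∷ y ∷ k ∷ [])))

mod-2-residue : ∀ i → ∃ λ (r : Fin 2) → i ≡ + toℕ r mod + 2
mod-2-residue i = fromℕ< i%2<2 , mod-by (divides (i / + 2) (begin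
    i - + toℕ (fromℕ< i%2<2)                  ≡⟨ cong (λ r → i - + r) (toℕ-fromℕ< i%2<2) ⟩
    i - + (i % + 2)                           ≡⟨ cong (_- + (i % + 2)) (a≡a%n+[a/n]*n i (+ 2)) ⟩
    + (i % + 2) + i / + 2 * + 2 - + (i % + 2) ≡⟨ cancel (+ (i % + 2)) (i / + 2 * + 2) ⟩
    i / + 2 * + 2                             ∎))
  where
  open ≡-Reasoning
  i%2<2 : i % + 2 < 2
  i%2<2 = n%d<d i (+ 2)
  cancel : ∀ r q → r + q - r ≡ q
  cancel = solve-∀

∣⇒≡0-mod : n ∣ₛ x → x ≡ + 0 mod n
∣⇒≡0-mod {x = x} n∣x = mod-by (∣-respʳ-≡ n∣x (sym (+-identityʳ x)))

m∣i⇒m*m∣i^d : ∀ {m i d} → d ≥ 2 → m ∣ₛ i → m * m ∣ₛ i ^ d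
m∣i⇒m*m∣i^d {m} (s≤s (s≤s {n = k} _)) (divides q refl) =
  divides (q * q * (q * m) ^ k) (regroup q m ((q * m) ^ k))
  where
  regroup : ∀ q m w → q * m * (q * m * w) ≡ q * q * w * (m * m)
  regroup = solve-∀

^-odd-≡-mod : x * x ≡ 1ℤ mod n → ∀ m → ¬ 2 ∣ m → x ^ m ≡ x mod n
^-odd-≡-mod _ zero ¬2∣0 = contradiction (2 ℕ.∣0) ¬2∣0
^-odd-≡-mod {x} _ 1 _ = ≡-mod-reflexive (*-identityʳ x)
^-odd-≡-mod {x} {n} x*x≡1 (suc (suc m)) ¬2∣2+m = begin
  x * (x * x ^ m) ≡⟨ *-assoc x x (x ^ m) ⟨
  x * x * x ^ m   ≈⟨ *-cong-mod x*x≡1 (^-odd-≡-mod x*x≡1 m ¬2∣m) ⟩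
  1ℤ * x          ≡⟨ *-identityˡ x ⟩
  x               ∎
  where
  open ≡-mod-Reasoning n
  ¬2∣m : ¬ 2 ∣ m
  ¬2∣m = ¬2∣2+m ∘ ℕ.∣m∣n⇒∣m+n ℕ.∣-refl

^-suc-≡-mod-2 : ∀ i k → i ^ suc k ≡ i mod + 2
^-suc-≡-mod-2 i k with mod-2-residue i
... | r , i≡r = begin
  i ^ suc k         ≈⟨ ^-cong-mod i≡r (suc k) ⟩
  (+ toℕ r) ^ suc k ≡⟨ residue-idempotent r ⟩
  + toℕ r           ≈⟨ i≡r ⟨
  i                 ∎
  where
  open ≡-mod-Reasoning (+ 2)
  residue-idempotent : ∀ (r : Fin 2) → (+ toℕ r) ^ suc k ≡ + toℕ r
  residue-idempotent Fin.zero           = refl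
  residue-idempotent (Fin.suc Fin.zero) = ^-zeroˡ (suc k)

≡-mod-2⇒^2-≡-mod-4 : x ≡ y mod + 2 → x ^ 2 ≡ y ^ 2 mod + 4
≡-mod-2⇒^2-≡-mod-4 {x} {y} (mod-by (divides q x-y≡2q)) = mod-by (divides (q * q + q * y) (begin
  x ^ 2 - y ^ 2                 ≡⟨ factor x y ⟩
  (x - y) * (x - y + y * + 2)   ≡⟨ cong (λ d → d * (d + y * + 2)) x-y≡2q ⟩
  q * + 2 * (q * + 2 + y * + 2) ≡⟨ expand q y ⟩
  (q * q + q * y) * + 4         ∎))
  where
  open ≡-Reasoning
  factor : ∀ a b → a * (a * + 1) - b * (b * + 1) ≡ (a - b) * (a - b + b * + 2)
  factor = solve-∀
  expand : ∀ a b → a * + 2 * (a * + 2 + b * + 2) ≡ (a * a + a * b) * + 4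
  expand = solve-∀

^-even-≡-^2-mod-4 : ∀ i {d} → d ≥ 2 → 2 ∣ d → i ^ d ≡ i ^ 2 mod + 4
^-even-≡-^2-mod-4 i ()  (ℕ.divides zero    refl)
^-even-≡-^2-mod-4 i _   (ℕ.divides (suc k) refl) = begin
  i ^ (suc k ℕ.* 2) ≡⟨ ^-*-assoc i (suc k) 2 ⟨
  (i ^ suc k) ^ 2   ≈⟨ ≡-mod-2⇒^2-≡-mod-4 (^-suc-≡-mod-2 i k) ⟩
  i ^ 2             ∎
  where open ≡-mod-Reasoning (+ 4)

Q : ℤ → ℤ → ℤ → ℤ
Q t y z = y ^ 2 + z ^ 2 - t * y * z * + 2

Q-cong : t ≡ t′ mod + 2 → y ≡ y′ mod + 2 → z ≡ z′ mod + 2 → Q t y z ≡ Q t′ y′ z′ mod + 4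
Q-cong t≡t′ y≡y′ z≡z′ = minus-cong-mod
  (+-cong-mod (≡-mod-2⇒^2-≡-mod-4 y≡y′) (≡-mod-2⇒^2-≡-mod-4 z≡z′))
  (*-scale-mod (+ 2) (*-cong-mod (*-cong-mod t≡t′ y≡y′) z≡z′))

Q-residues : ∀ (r s u : Fin 2) → ¬ Q (+ toℕ r) (+ toℕ s) (+ toℕ u) ≡ + 3 mod + 4
Q-residues = from-yes (all? λ (r : Fin 2) → all? λ (s : Fin 2) → all? λ (u : Fin 2) →
  ¬? (Q (+ toℕ r) (+ toℕ s) (+ toℕ u) ≡? + 3 mod + 4))

Q≢3-mod-4 : ∀ t y z → ¬ Q t y z ≡ + 3 mod + 4
Q≢3-mod-4 t y z Q≡3 =
  let r , t≡r = mod-2-residue t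
      s , y≡s = mod-2-residue y
      u , z≡u = mod-2-residue z
  in Q-residues r s u (≡-mod-trans (≡-mod-sym (Q-cong t≡r y≡s z≡u)) Q≡3)

isolate-quadratic-part : ∀ A Y Z B t y z →
  A - Y - Z + t * + 2 * y * z - B ≡ + 0 → Y + Z - t * y * z * + 2 ≡ A - B
isolate-quadratic-part A Y Z B t y z E≡0 = begin
  Y + Z - t * y * z * + 2                            ≡⟨ regroup A Y Z B t y z ⟩
  A - B - (A - Y - Z + t * + 2 * y * z - B)          ≡⟨ cong (A - B -_) E≡0 ⟩
  A - B + + 0                                        ≡⟨ +-identityʳ (A - B) ⟩
  A - B                                              ∎
  where
  open ≡-Reasoning
  regroup : ∀ A Y Z B t y z →
            Y + Z - t * y * z * + 2 ≡ A - B - (A - Y - Z + t * + 2 * y * z - B)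
  regroup = solve-∀

corollary2p2 : (a b : ℤ) (d₁ d₂ m : ℕ) →
    (+ 12) ∣ℤ (a - + 1) →
    b ≡ (+ 2) ^ d₁ * a - (+ 3) ^ m →
    1 ≤ m → ¬ (2 ∣ m) →
    d₁ ≥ 3 → 3 ∣ d₁ →
    d₂ ≥ 2 → 2 ∣ d₂ →
    gcd d₁ d₂ ≡ 1 →
    ¬ (Σ ℤ λ x → Σ ℤ λ y → Σ ℤ λ z →
        ((+ 2) ∣ℤ x) × (a * x ^ d₁ - y ^ d₂ - z ^ 2 + x * y * z - b ≡ + 0))
corollary2p2 a b d₁ d₂ m _ b≡ _ m-odd d₁≥3 _ d₂≥2 2∣d₂ _ (x , y , z , 2∣x , equation)
  with divides t refl ← ∣ᵤ⇒∣ {+ 2} {x} 2∣x = Q≢3-mod-4 t y z (begin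
    Q t y z                                     ≈⟨ y^d₂↦y² ⟨
    y ^ d₂ + z ^ 2 - t * y * z * + 2            ≡⟨ solved-for-Q ⟩
    a * x ^ d₁ - b                              ≡⟨ cong (a * x ^ d₁ -_) b≡ ⟩
    a * x ^ d₁ - ((+ 2) ^ d₁ * a - (+ 3) ^ m)   ≈⟨ reduce x^d₁≡0 2^d₁≡0 3^m≡3 ⟩
    a * + 0 - (+ 0 * a - + 3)                   ≡⟨ collapse a ⟩
    + 3                                         ∎)
  where
  open ≡-mod-Reasoning (+ 4)
  y^d₂↦y² : y ^ d₂ + z ^ 2 - t * y * z * + 2 ≡ Q t y z mod + 4
  y^d₂↦y² = minus-cong-mod (+-cong-mod (^-even-≡-^2-mod-4 y d₂≥2 2∣d₂) ≡-mod-refl) ≡-mod-refl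
  reduce : ∀ {X P T X′ P′ T′} → X ≡ X′ mod + 4 → P ≡ P′ mod + 4 → T ≡ T′ mod + 4 →
           a * X - (P * a - T) ≡ a * X′ - (P′ * a - T′) mod + 4
  reduce X≡ P≡ T≡ =
    minus-cong-mod (*-cong-mod (≡-mod-refl {x = a}) X≡) (minus-cong-mod (*-cong-mod P≡ (≡-mod-refl {x = a})) T≡)
  solved-for-Q : y ^ d₂ + z ^ 2 - t * y * z * + 2 ≡ a * x ^ d₁ - b
  solved-for-Q = isolate-quadratic-part (a * x ^ d₁) (y ^ d₂) (z ^ 2) b t y z equation
  x^d₁≡0 : x ^ d₁ ≡ + 0 mod + 4
  x^d₁≡0 = ∣⇒≡0-mod (m∣i⇒m*m∣i^d {+ 2} (ℕ.<⇒≤ d₁≥3) (∣ᵤ⇒∣ 2∣x))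
  2^d₁≡0 : (+ 2) ^ d₁ ≡ + 0 mod + 4
  2^d₁≡0 = ∣⇒≡0-mod (m∣i⇒m*m∣i^d {+ 2} (ℕ.<⇒≤ d₁≥3) (∣-refl {+ 2}))
  3^m≡3 : (+ 3) ^ m ≡ + 3 mod + 4
  3^m≡3 = ^-odd-≡-mod (mod-by (divides (+ 2) refl)) m m-odd
  collapse : ∀ a → a * + 0 - (+ 0 * a - + 3) ≡ + 3
  collapse = solve-∀
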